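{- Let $\Gamma$ be a finite graph and $G\leqslant\mathrm{Aut}(\Gamma)$ acting biquasiprimitively on the vertex set of $\Gamma$, and suppose $\Gamma$ is not complete bipartite. Then $G^+$ acts faithfully on each of its two orbits on vertices.
   Context: A transitive permutation group is biquasiprimitive if it is not quasiprimitive (i.e. some nontrivial normal subgroup is intransitive) and every normal subgroup has at most two orbits. Here $\Gamma$ is bipartite with two bipartite halves and $G^+$ denotes the index-two subgroup of $G$ fixing each bipartite half setwise; its orbits on vertices are the two halves. -}

module Defs where

open import Data.Nat using (ℕ)
open import Data.Fin using (Fin)
open import Data.Bool using (Bool)
open import Data.Fin.Permutation using (Permutation′; _⟨$⟩ʳ_; _⟨$⟩ˡ_)
open import Data.Product using (Σ; _×_; ∃; ∃-syntax; _,_)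
open import Data.Sum using (_⊎_)
open import Relation.Nullary using (¬_)
open import Relation.Binary.PropositionalEquality using (_≡_; _≢_)
open import Relation.Binary.Construct.Closure.ReflexiveTransitive using (Star)

PermSet : ℕ → Set₁
PermSet n = Permutation′ n → Set

record IsSubgroup {n : ℕ} (H : PermSet n) : Set where
  field
    has-id  : ∃[ e ] (H e × (∀ x → e ⟨$⟩ʳ x ≡ x))
    has-mul : ∀ g h → H g → H h → ∃[ k ] (H k × (∀ x → k ⟨$⟩ʳ x ≡ g ⟨$⟩ʳ (h ⟨$⟩ʳ x)))
    has-inv : ∀ g → H g → ∃[ k ] (H k × (∀ x → k ⟨$⟩ʳ x ≡ g ⟨$⟩ˡ x))

record IsNormalSubgroup {n : ℕ} (N G : PermSet n) : Set where
  field
    subgroup : IsSubgroup N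
    ⊆G       : ∀ h → N h → G h
    conj     : ∀ g h → G g → N h →
               ∃[ k ] (N k × (∀ x → k ⟨$⟩ʳ x ≡ g ⟨$⟩ʳ (h ⟨$⟩ʳ (g ⟨$⟩ˡ x))))

Transitive : {n : ℕ} → PermSet n → Set
Transitive {n} H = ∀ (u v : Fin n) → ∃[ h ] (H h × h ⟨$⟩ʳ u ≡ v)

AtMostTwoOrbits : {n : ℕ} → PermSet n → Set
AtMostTwoOrbits {n} H =
  ∃[ a ] ∃[ b ] (∀ (v : Fin n) → ∃[ h ] (H h × (h ⟨$⟩ʳ a ≡ v ⊎ h ⟨$⟩ʳ b ≡ v)))

Nontrivial : {n : ℕ} → PermSet n → Set
Nontrivial H = ∃[ h ] (H h × ∃[ x ] (h ⟨$⟩ʳ x ≢ x))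

Quasiprimitive : {n : ℕ} → PermSet n → Set₁
Quasiprimitive {n} G =
  Transitive G × (∀ (N : PermSet n) → IsNormalSubgroup N G → Nontrivial N → Transitive N)

Biquasiprimitive : {n : ℕ} → PermSet n → Set₁
Biquasiprimitive {n} G =
  Transitive G × ¬ Quasiprimitive G ×
  (∀ (N : PermSet n) → IsNormalSubgroup N G → Nontrivial N → AtMostTwoOrbits N)

record Graph (n : ℕ) : Set₁ where
  field
    Adj : Fin n → Fin n → Set
    sym : ∀ u v → Adj u v → Adj v u
    irr : ∀ u → ¬ Adj u u

IsAutGroup : {n : ℕ} → Graph n → PermSet n → Set
IsAutGroup Γ G =
  IsSubgroup G ×
  (∀ g → G g → ∀ u v → (Graph.Adj Γ u v → Graph.Adj Γ (g ⟨$⟩ʳ u) (g ⟨$⟩ʳ v))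
                     × (Graph.Adj Γ (g ⟨$⟩ʳ u) (g ⟨$⟩ʳ v) → Graph.Adj Γ u v))

Connected : {n : ℕ} → Graph n → Set
Connected {n} Γ = ∀ (u v : Fin n) → Star (Graph.Adj Γ) u v

IsBipartition : {n : ℕ} → Graph n → (Fin n → Bool) → Set
IsBipartition Γ side = ∀ u v → Graph.Adj Γ u v → side u ≢ side v

IsCompleteBipartite : {n : ℕ} → Graph n → (Fin n → Bool) → Set
IsCompleteBipartite Γ side = ∀ u v → side u ≢ side v → Graph.Adj Γ u v

Plus : {n : ℕ} → PermSet n → (Fin n → Bool) → PermSet n
Plus G side g = G g × (∀ x → side (g ⟨$⟩ʳ x) ≡ side x)

FaithfulOn : {n : ℕ} → PermSet n → (Fin n → Bool) → Bool → Set
FaithfulOn H side b =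
  ∀ h → H h → (∀ x → side x ≡ b → h ⟨$⟩ʳ x ≡ x) → ∀ x → h ⟨$⟩ʳ x ≡ x

module Submission where

-- Let K_c ≤ G⁺ be the kernel of G⁺ on the
-- half c, i.e. the elements of G⁺ fixing that half pointwise, and let
-- N = K_true K_false: an element k ∈ G⁺ lies in N when, for each half c, its
-- action off c is realised by an element of K_c.  Since every element of G
-- maps halves to halves, conjugation by G permutes {K_true, K_false}, so N is
-- normal in G.  If G⁺ is not faithful on the half b, a nontrivial element of
-- K_b lies in N, so by biquasiprimitivity N has at most two orbits; as N
-- preserves both (nonempty) halves it is transitive on each of them, and
-- hence K_c is transitive on the half opposite to c.  Then for a vertex u
-- with a neighbour w (connectivity) the stabiliser K_{side u} moves w to any
-- vertex v of w's half, which makes Γ complete bipartite — a contradiction.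

open import Defs
open import Data.Nat using (ℕ)
open import Data.Fin using (Fin)
open import Data.Fin.Permutation using (Permutation′; _⟨$⟩ʳ_; _⟨$⟩ˡ_; inverseˡ; inverseʳ)
open import Data.Bool using (Bool; true; false; not)
open import Data.Bool.Properties using (¬-not; not-¬)
open import Data.Product using (_×_; ∃-syntax; _,_; proj₁; proj₂)
open import Data.Sum using (_⊎_; inj₁; inj₂)
open import Data.Empty using (⊥-elim)
open import Relation.Nullary using (¬_; yes; no)
open import Relation.Binary.PropositionalEquality
open import Relation.Binary.Construct.Closure.ReflexiveTransitive using (ε; _◅_)
import Data.Fin as Fin
import Data.Bool as Bool

both-differ : ∀ {a b c : Bool} → a ≢ c → b ≢ c → a ≡ b
both-differ a≢c b≢c = trans (¬-not a≢c) (sym (¬-not b≢c))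

module Subgroup {n : ℕ} {H : PermSet n} (H-sub : IsSubgroup H) where
  open IsSubgroup H-sub

  conjugate : ∀ g p → H g → H p →
              ∃[ k ] (H k × (∀ x → k ⟨$⟩ʳ x ≡ g ⟨$⟩ʳ (p ⟨$⟩ʳ (g ⟨$⟩ˡ x))))
  conjugate g p g∈H p∈H with has-inv g g∈H
  ... | i , i∈H , i≗g⁻¹ with has-mul p i p∈H i∈H
  ... | pi , pi∈H , pi≗p∘i with has-mul g pi g∈H pi∈H
  ... | k , k∈H , k≗g∘pi = k , k∈H , λ x → begin
      k ⟨$⟩ʳ x                          ≡⟨ k≗g∘pi x ⟩
      g ⟨$⟩ʳ (pi ⟨$⟩ʳ x)                ≡⟨ cong (g ⟨$⟩ʳ_) (pi≗p∘i x) ⟩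
      g ⟨$⟩ʳ (p ⟨$⟩ʳ (i ⟨$⟩ʳ x))        ≡⟨ cong (λ y → g ⟨$⟩ʳ (p ⟨$⟩ʳ y)) (i≗g⁻¹ x) ⟩
      g ⟨$⟩ʳ (p ⟨$⟩ʳ (g ⟨$⟩ˡ x))        ∎
    where open ≡-Reasoning

  same-orbit : ∀ {m₁ m₂ p y z} → H m₁ → H m₂ → m₁ ⟨$⟩ʳ p ≡ y → m₂ ⟨$⟩ʳ p ≡ z →
               ∃[ k ] (H k × k ⟨$⟩ʳ y ≡ z)
  same-orbit {m₁} {m₂} {p} {y} {z} m₁∈H m₂∈H m₁p≡y m₂p≡z with has-inv m₁ m₁∈H
  ... | i , i∈H , i≗m₁⁻¹ with has-mul m₂ i m₂∈H i∈H
  ... | k , k∈H , k≗m₂∘i = k , k∈H , (begin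
      k ⟨$⟩ʳ y                        ≡⟨ k≗m₂∘i y ⟩
      m₂ ⟨$⟩ʳ (i ⟨$⟩ʳ y)              ≡⟨ cong (m₂ ⟨$⟩ʳ_) (i≗m₁⁻¹ y) ⟩
      m₂ ⟨$⟩ʳ (m₁ ⟨$⟩ˡ y)             ≡⟨ cong (λ q → m₂ ⟨$⟩ʳ (m₁ ⟨$⟩ˡ q)) (sym m₁p≡y) ⟩
      m₂ ⟨$⟩ʳ (m₁ ⟨$⟩ˡ (m₁ ⟨$⟩ʳ p))   ≡⟨ cong (m₂ ⟨$⟩ʳ_) (inverseˡ m₁) ⟩
      m₂ ⟨$⟩ʳ p                       ≡⟨ m₂p≡z ⟩
      z                               ∎)
    where open ≡-Reasoning

module Halves {n : ℕ} (side : Fin n → Bool) where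

  PreservesSides : Permutation′ n → Set
  PreservesSides k = ∀ x → side (k ⟨$⟩ʳ x) ≡ side x

  Fixes : Bool → Permutation′ n → Set
  Fixes c k = ∀ x → side x ≡ c → k ⟨$⟩ʳ x ≡ x

  AgreeOff : Bool → Permutation′ n → Permutation′ n → Set
  AgreeOff c k k′ = ∀ x → side x ≢ c → k ⟨$⟩ʳ x ≡ k′ ⟨$⟩ʳ x

  preserves-∘ : ∀ g h k → PreservesSides g → PreservesSides h →
                (∀ x → k ⟨$⟩ʳ x ≡ g ⟨$⟩ʳ (h ⟨$⟩ʳ x)) → PreservesSides k
  preserves-∘ g h k g-pres h-pres k≗g∘h x =
    trans (cong side (k≗g∘h x)) (trans (g-pres (h ⟨$⟩ʳ x)) (h-pres x))

  preserves-⁻¹ : ∀ g k → PreservesSides g → (∀ x → k ⟨$⟩ʳ x ≡ g ⟨$⟩ˡ x) → PreservesSides k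
  preserves-⁻¹ g k g-pres k≗g⁻¹ x =
    trans (cong side (k≗g⁻¹ x)) (trans (sym (g-pres (g ⟨$⟩ˡ x))) (cong side (inverseʳ g)))

  preserves-id : ∀ e → (∀ x → e ⟨$⟩ʳ x ≡ x) → PreservesSides e
  preserves-id e e≗id x = cong side (e≗id x)

  fixes-∘ : ∀ {c} g h k → Fixes c g → Fixes c h →
            (∀ x → k ⟨$⟩ʳ x ≡ g ⟨$⟩ʳ (h ⟨$⟩ʳ x)) → Fixes c k
  fixes-∘ g h k g-fix h-fix k≗g∘h x x∈c =
    trans (k≗g∘h x) (trans (cong (g ⟨$⟩ʳ_) (h-fix x x∈c)) (g-fix x x∈c))

  fixes-⁻¹ : ∀ {c} g k → Fixes c g → (∀ x → k ⟨$⟩ʳ x ≡ g ⟨$⟩ˡ x) → Fixes c k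
  fixes-⁻¹ g k g-fix k≗g⁻¹ x x∈c =
    trans (k≗g⁻¹ x) (trans (cong (g ⟨$⟩ˡ_) (sym (g-fix x x∈c))) (inverseˡ g))

  fixes-conj : ∀ {c c′} g h k → (∀ x → side x ≡ c → side (g ⟨$⟩ˡ x) ≡ c′) → Fixes c′ h →
               (∀ x → k ⟨$⟩ʳ x ≡ g ⟨$⟩ʳ (h ⟨$⟩ʳ (g ⟨$⟩ˡ x))) → Fixes c k
  fixes-conj g h k g⁻¹-maps h-fix k≗conj x x∈c =
    trans (k≗conj x) (trans (cong (g ⟨$⟩ʳ_) (h-fix _ (g⁻¹-maps x x∈c))) (inverseʳ g))

  agreeOff-∘ : ∀ {c} g g₁ h h₁ k m → AgreeOff c g g₁ → AgreeOff c h h₁ → PreservesSides h →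
               (∀ x → k ⟨$⟩ʳ x ≡ g ⟨$⟩ʳ (h ⟨$⟩ʳ x)) → (∀ x → m ⟨$⟩ʳ x ≡ g₁ ⟨$⟩ʳ (h₁ ⟨$⟩ʳ x)) →
               AgreeOff c k m
  agreeOff-∘ g g₁ h h₁ k m g~g₁ h~h₁ h-pres k≗g∘h m≗g₁∘h₁ x x∉c = begin
      k ⟨$⟩ʳ x                ≡⟨ k≗g∘h x ⟩
      g ⟨$⟩ʳ (h ⟨$⟩ʳ x)       ≡⟨ g~g₁ (h ⟨$⟩ʳ x) (λ hx∈c → x∉c (trans (sym (h-pres x)) hx∈c)) ⟩
      g₁ ⟨$⟩ʳ (h ⟨$⟩ʳ x)      ≡⟨ cong (g₁ ⟨$⟩ʳ_) (h~h₁ x x∉c) ⟩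
      g₁ ⟨$⟩ʳ (h₁ ⟨$⟩ʳ x)     ≡⟨ sym (m≗g₁∘h₁ x) ⟩
      m ⟨$⟩ʳ x                ∎
    where open ≡-Reasoning

  agreeOff-⁻¹ : ∀ {c} g g₁ k m → AgreeOff c g g₁ → PreservesSides g₁ →
                (∀ x → k ⟨$⟩ʳ x ≡ g ⟨$⟩ˡ x) → (∀ x → m ⟨$⟩ʳ x ≡ g₁ ⟨$⟩ˡ x) → AgreeOff c k m
  agreeOff-⁻¹ g g₁ k m g~g₁ g₁-pres k≗g⁻¹ m≗g₁⁻¹ x x∉c = begin
      k ⟨$⟩ʳ x                  ≡⟨ k≗g⁻¹ x ⟩
      g ⟨$⟩ˡ x                  ≡⟨ cong (g ⟨$⟩ˡ_) (sym g-y≡x) ⟩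
      g ⟨$⟩ˡ (g ⟨$⟩ʳ y)         ≡⟨ inverseˡ g ⟩
      y                         ≡⟨ sym (m≗g₁⁻¹ x) ⟩
      m ⟨$⟩ʳ x                  ∎
    where
    open ≡-Reasoning
    y = g₁ ⟨$⟩ˡ x
    g-y≡x : g ⟨$⟩ʳ y ≡ x
    g-y≡x = trans (g~g₁ y (λ y∈c → x∉c (trans (trans (cong side (sym (inverseʳ g₁))) (g₁-pres y)) y∈c)))
                  (inverseʳ g₁)

  agreeOff-conj : ∀ {c c′} g h h₁ k m → (∀ x → side (g ⟨$⟩ˡ x) ≡ c′ → side x ≡ c) →
                  AgreeOff c′ h h₁ →
                  (∀ x → k ⟨$⟩ʳ x ≡ g ⟨$⟩ʳ (h ⟨$⟩ʳ (g ⟨$⟩ˡ x))) →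
                  (∀ x → m ⟨$⟩ʳ x ≡ g ⟨$⟩ʳ (h₁ ⟨$⟩ʳ (g ⟨$⟩ˡ x))) → AgreeOff c k m
  agreeOff-conj g h h₁ k m g⁻¹-reflects h~h₁ k≗conj m≗conj x x∉c =
    trans (k≗conj x)
      (trans (cong (g ⟨$⟩ʳ_) (h~h₁ _ (λ g⁻¹x∈c′ → x∉c (g⁻¹-reflects x g⁻¹x∈c′))))
             (sym (m≗conj x)))

  -- A subgroup preserving both (nonempty) halves and having at most two
  -- orbits is transitive on each half: its two orbit representatives must
  -- lie in different halves.
  module TwoOrbits {H : PermSet n} (H-sub : IsSubgroup H)
                   (H-pres : ∀ h → H h → PreservesSides h)
                   (nonempty : ∀ c → ∃[ z ] (side z ≡ c)) where
    open Subgroup H-sub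

    Reaches : Fin n → Fin n → Set
    Reaches r v = ∃[ m ] (H m × m ⟨$⟩ʳ r ≡ v)

    reaches-side : ∀ {r v} → Reaches r v → side v ≡ side r
    reaches-side (m , m∈H , mr≡v) = trans (cong side (sym mr≡v)) (H-pres m m∈H _)

    representatives-apart : ∀ {a b} → (∀ v → Reaches a v ⊎ Reaches b v) → side a ≢ side b
    representatives-apart {a} {b} cover a≡b with nonempty (not (side a))
    ... | w , w∈¬a with cover w
    ... | inj₁ a→w = not-¬ refl (trans (sym (reaches-side a→w)) w∈¬a)
    ... | inj₂ b→w = not-¬ refl (trans (trans a≡b (sym (reaches-side b→w))) w∈¬a)

    transitive-on-halves : AtMostTwoOrbits H → ∀ y z → side y ≡ side z → Reaches y z
    transitive-on-halves (a , b , orbits) y z y~z = join (cover y) (cover z)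
      where
      cover : ∀ v → Reaches a v ⊎ Reaches b v
      cover v with orbits v
      ... | m , m∈H , inj₁ ma≡v = inj₁ (m , m∈H , ma≡v)
      ... | m , m∈H , inj₂ mb≡v = inj₂ (m , m∈H , mb≡v)

      apart : side a ≢ side b
      apart = representatives-apart cover

      join : Reaches a y ⊎ Reaches b y → Reaches a z ⊎ Reaches b z → Reaches y z
      join (inj₁ (_ , m₁∈H , e₁)) (inj₁ (_ , m₂∈H , e₂)) = same-orbit m₁∈H m₂∈H e₁ e₂
      join (inj₂ (_ , m₁∈H , e₁)) (inj₂ (_ , m₂∈H , e₂)) = same-orbit m₁∈H m₂∈H e₁ e₂
      join (inj₁ a→y) (inj₂ b→z) =
        ⊥-elim (apart (trans (sym (reaches-side a→y)) (trans y~z (reaches-side b→z))))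
      join (inj₂ b→y) (inj₁ a→z) =
        ⊥-elim (apart (trans (sym (reaches-side a→z)) (trans (sym y~z) (reaches-side b→y))))

module Kernels {n : ℕ} (G : PermSet n) (G-sub : IsSubgroup G) (side : Fin n → Bool)
               (nonempty : ∀ c → ∃[ z ] (side z ≡ c))
               (G-maps-halves : ∀ g → G g → ∀ u v → side u ≡ side v →
                                side (g ⟨$⟩ʳ u) ≡ side (g ⟨$⟩ʳ v)) where
  open IsSubgroup G-sub
  open Subgroup G-sub using (conjugate)
  open Halves side

  G⁺ : PermSet n
  G⁺ = Plus G side

  Kernel : Bool → PermSet n
  Kernel c k = G⁺ k × Fixes c k

  Product : PermSet n
  Product k = G⁺ k × (∀ c → ∃[ k₁ ] (Kernel c k₁ × AgreeOff c k k₁))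

  half-image : ∀ g → G g → ∀ c → ∃[ c′ ] ((∀ x → side x ≡ c → side (g ⟨$⟩ˡ x) ≡ c′)
                                          × (∀ x → side (g ⟨$⟩ˡ x) ≡ c′ → side x ≡ c))
  half-image g g∈G c with nonempty c | has-inv g g∈G
  ... | z , z∈c | i , i∈G , i≗g⁻¹ = side (g ⟨$⟩ˡ z) , into , back
    where
    into : ∀ x → side x ≡ c → side (g ⟨$⟩ˡ x) ≡ side (g ⟨$⟩ˡ z)
    into x x∈c = trans (cong side (sym (i≗g⁻¹ x)))
                   (trans (G-maps-halves i i∈G x z (trans x∈c (sym z∈c))) (cong side (i≗g⁻¹ z)))

    back : ∀ x → side (g ⟨$⟩ˡ x) ≡ side (g ⟨$⟩ˡ z) → side x ≡ c
    back x same = trans (cong side (sym (inverseʳ g)))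
                    (trans (G-maps-halves g g∈G _ _ same) (trans (cong side (inverseʳ g)) z∈c))

  kernel-id : ∀ {e} → G e → (∀ x → e ⟨$⟩ʳ x ≡ x) → ∀ c → Kernel c e
  kernel-id {e} e∈G e≗id c = (e∈G , preserves-id e e≗id) , λ x _ → e≗id x

  kernel-∘ : ∀ {c} g h → Kernel c g → Kernel c h →
             ∃[ k ] (Kernel c k × (∀ x → k ⟨$⟩ʳ x ≡ g ⟨$⟩ʳ (h ⟨$⟩ʳ x)))
  kernel-∘ g h ((g∈G , g-pres) , g-fix) ((h∈G , h-pres) , h-fix) with has-mul g h g∈G h∈G
  ... | k , k∈G , k≗g∘h =
    k , ((k∈G , preserves-∘ g h k g-pres h-pres k≗g∘h) , fixes-∘ g h k g-fix h-fix k≗g∘h) , k≗g∘h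

  kernel-⁻¹ : ∀ {c} g → Kernel c g → ∃[ k ] (Kernel c k × (∀ x → k ⟨$⟩ʳ x ≡ g ⟨$⟩ˡ x))
  kernel-⁻¹ g ((g∈G , g-pres) , g-fix) with has-inv g g∈G
  ... | k , k∈G , k≗g⁻¹ = k , ((k∈G , preserves-⁻¹ g k g-pres k≗g⁻¹) , fixes-⁻¹ g k g-fix k≗g⁻¹) , k≗g⁻¹

  plus-conj : ∀ g h k → G g → G⁺ h → G k →
              (∀ x → k ⟨$⟩ʳ x ≡ g ⟨$⟩ʳ (h ⟨$⟩ʳ (g ⟨$⟩ˡ x))) → G⁺ k
  plus-conj g h k g∈G (_ , h-pres) k∈G k≗conj = k∈G , λ x →
    trans (cong side (k≗conj x))
      (trans (G-maps-halves g g∈G _ _ (h-pres (g ⟨$⟩ˡ x))) (cong side (inverseʳ g)))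

  kernel-conj : ∀ {c c′} g h → G g → (∀ x → side x ≡ c → side (g ⟨$⟩ˡ x) ≡ c′) → Kernel c′ h →
                ∃[ k ] (Kernel c k × (∀ x → k ⟨$⟩ʳ x ≡ g ⟨$⟩ʳ (h ⟨$⟩ʳ (g ⟨$⟩ˡ x))))
  kernel-conj g h g∈G g⁻¹-maps (h∈G⁺ , h-fix) with conjugate g h g∈G (proj₁ h∈G⁺)
  ... | k , k∈G , k≗conj =
    k , (plus-conj g h k g∈G h∈G⁺ k∈G k≗conj , fixes-conj g h k g⁻¹-maps h-fix k≗conj) , k≗conj

  product-normal : IsNormalSubgroup Product G
  product-normal = record
    { subgroup = record { has-id = product-id ; has-mul = product-∘ ; has-inv = product-⁻¹ }
    ; ⊆G       = λ h h∈N → proj₁ (proj₁ h∈N)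
    ; conj     = product-conj }
    where
    product-id : ∃[ e ] (Product e × (∀ x → e ⟨$⟩ʳ x ≡ x))
    product-id with has-id
    ... | e , e∈G , e≗id =
      e , ((e∈G , preserves-id e e≗id) , λ c → e , kernel-id e∈G e≗id c , λ _ _ → refl) , e≗id

    product-∘ : ∀ g h → Product g → Product h →
                ∃[ k ] (Product k × (∀ x → k ⟨$⟩ʳ x ≡ g ⟨$⟩ʳ (h ⟨$⟩ʳ x)))
    product-∘ g h ((g∈G , g-pres) , g-split) ((h∈G , h-pres) , h-split) with has-mul g h g∈G h∈G
    ... | k , k∈G , k≗g∘h = k , ((k∈G , preserves-∘ g h k g-pres h-pres k≗g∘h) , realise) , k≗g∘h
      where
      realise : ∀ c → ∃[ k₁ ] (Kernel c k₁ × AgreeOff c k k₁)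
      realise c with g-split c | h-split c
      ... | g₁ , g₁∈K , g~g₁ | h₁ , h₁∈K , h~h₁ with kernel-∘ g₁ h₁ g₁∈K h₁∈K
      ... | m , m∈K , m≗g₁∘h₁ = m , m∈K , agreeOff-∘ g g₁ h h₁ k m g~g₁ h~h₁ h-pres k≗g∘h m≗g₁∘h₁

    product-⁻¹ : ∀ g → Product g → ∃[ k ] (Product k × (∀ x → k ⟨$⟩ʳ x ≡ g ⟨$⟩ˡ x))
    product-⁻¹ g ((g∈G , g-pres) , g-split) with has-inv g g∈G
    ... | k , k∈G , k≗g⁻¹ = k , ((k∈G , preserves-⁻¹ g k g-pres k≗g⁻¹) , realise) , k≗g⁻¹
      where
      realise : ∀ c → ∃[ k₁ ] (Kernel c k₁ × AgreeOff c k k₁)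
      realise c with g-split c
      ... | g₁ , g₁∈K , g~g₁ with kernel-⁻¹ g₁ g₁∈K
      ... | m , m∈K , m≗g₁⁻¹ = m , m∈K , agreeOff-⁻¹ g g₁ k m g~g₁ (proj₂ (proj₁ g₁∈K)) k≗g⁻¹ m≗g₁⁻¹

    product-conj : ∀ g h → G g → Product h →
                   ∃[ k ] (Product k × (∀ x → k ⟨$⟩ʳ x ≡ g ⟨$⟩ʳ (h ⟨$⟩ʳ (g ⟨$⟩ˡ x))))
    product-conj g h g∈G (h∈G⁺ , h-split) with conjugate g h g∈G (proj₁ h∈G⁺)
    ... | k , k∈G , k≗conj = k , (plus-conj g h k g∈G h∈G⁺ k∈G k≗conj , realise) , k≗conj
      where
      realise : ∀ c → ∃[ k₁ ] (Kernel c k₁ × AgreeOff c k k₁)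
      realise c with half-image g g∈G c
      ... | c′ , g⁻¹-maps , g⁻¹-reflects with h-split c′
      ... | h₁ , h₁∈K , h~h₁ with kernel-conj g h₁ g∈G g⁻¹-maps h₁∈K
      ... | m , m∈K , m≗conj = m , m∈K , agreeOff-conj g h h₁ k m g⁻¹-reflects h~h₁ k≗conj m≗conj

  kernel⊆product : ∀ b h → Kernel b h → Product h
  kernel⊆product b h (h∈G⁺ , h-fix) = h∈G⁺ , realise
    where
    realise : ∀ c → ∃[ k₁ ] (Kernel c k₁ × AgreeOff c h k₁)
    realise c with c Bool.≟ b
    ... | yes refl = h , (h∈G⁺ , h-fix) , λ _ _ → refl
    ... | no c≢b with has-id
    ... | e , e∈G , e≗id = e , kernel-id e∈G e≗id c , λ x x∉c →
          trans (h-fix x (both-differ x∉c (λ b≡c → c≢b (sym b≡c)))) (sym (e≗id x))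

  kernel-transitive : (∀ y z → side y ≡ side z → ∃[ k ] (Product k × k ⟨$⟩ʳ y ≡ z)) →
                      ∀ c w v → side w ≢ c → side w ≡ side v → ∃[ k ] (Kernel c k × k ⟨$⟩ʳ w ≡ v)
  kernel-transitive N-trans c w v w∉c w~v with N-trans w v w~v
  ... | k , (_ , k-split) , kw≡v with k-split c
  ... | k₁ , k₁∈K , k~k₁ = k₁ , k₁∈K , trans (sym (k~k₁ w w∉c)) kw≡v

-- A connected bipartite graph is complete bipartite as soon as, for every
-- vertex u, the stabiliser of u in some G ≤ Aut(Γ) can map any vertex of the
-- other half to any other: map a neighbour of u to the given vertex v.
complete-bipartite-criterion :
  ∀ {n} (Γ : Graph n) (G : PermSet n) (side : Fin n → Bool) →
  IsAutGroup Γ G → Connected Γ → IsBipartition Γ side →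
  (∀ u w v → side w ≢ side u → side w ≡ side v →
     ∃[ k ] (G k × k ⟨$⟩ʳ u ≡ u × k ⟨$⟩ʳ w ≡ v)) →
  IsCompleteBipartite Γ side
complete-bipartite-criterion Γ G side (_ , G-aut) connected bipartite stabiliser-trans u v u≁v
  with connected u v
... | ε = ⊥-elim (u≁v refl)
... | _◅_ {j = w} u~w _ with stabiliser-trans u w v w∉u (both-differ w∉u (λ v≡u → u≁v (sym v≡u)))
  where w∉u = λ w≡u → bipartite u w u~w (sym w≡u)
... | k , k∈G , ku≡u , kw≡v = subst₂ (Graph.Adj Γ) ku≡u kw≡v (proj₁ (G-aut k k∈G u w) u~w)

lemma3p6 : (n : ℕ) (Γ : Graph n) (G : PermSet n) (side : Fin n → Bool) →
    Connected Γ →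
    IsAutGroup Γ G →
    Biquasiprimitive G →
    IsBipartition Γ side →
    (∃[ u ] (side u ≡ true)) × (∃[ v ] (side v ≡ false)) →
    (∀ g → G g → ∀ u v → side u ≡ side v → side (g ⟨$⟩ʳ u) ≡ side (g ⟨$⟩ʳ v)) →
    ¬ IsCompleteBipartite Γ side →
    (∀ b → FaithfulOn (Plus G side) side b)
lemma3p6 n Γ G side connected G≤Aut (_ , _ , normal-orbits) bipartite (t , f) G-maps-halves
         not-complete b h h∈G⁺ h-fix x with h ⟨$⟩ʳ x Fin.≟ x
... | yes hx≡x = hx≡x
... | no hx≢x = ⊥-elim (not-complete
        (complete-bipartite-criterion Γ G side G≤Aut connected bipartite stabiliser-trans))
  where
  nonempty : ∀ c → ∃[ z ] (side z ≡ c)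
  nonempty true  = t
  nonempty false = f

  open Kernels G (proj₁ G≤Aut) side nonempty G-maps-halves
  open Halves.TwoOrbits side (IsNormalSubgroup.subgroup product-normal)
                        (λ k k∈N → proj₂ (proj₁ k∈N)) nonempty

  -- h is a nontrivial element of K_b ⊆ N, so N has at most two orbits.
  N-transitive : ∀ y z → side y ≡ side z → ∃[ k ] (Product k × k ⟨$⟩ʳ y ≡ z)
  N-transitive = transitive-on-halves
    (normal-orbits Product product-normal (h , kernel⊆product b h (h∈G⁺ , h-fix) , x , hx≢x))

  stabiliser-trans : ∀ u w v → side w ≢ side u → side w ≡ side v →
                     ∃[ k ] (G k × k ⟨$⟩ʳ u ≡ u × k ⟨$⟩ʳ w ≡ v)
  stabiliser-trans u w v w∉u w~v with kernel-transitive N-transitive (side u) w v w∉u w~v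
  ... | k , ((k∈G , _) , k-fix) , kw≡v = k , k∈G , k-fix u refl , kw≡v
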